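{- Let $n\ge 1$, let $T\in\mathbb{T}_n$ and let $v,w$ be nodes of $T$. Then $T(v)\equiv T(w)$ if and only if $v\sim w$.
   Context: Let $\mathbb{T}$ be the set of finite rooted trees in which every internal (non-leaf) node has at least two children. For a node $v$ of $T\in\mathbb{T}$, $T(v)$ denotes the subtree of $T$ rooted at $v$ (consisting of $v$ and all its descendants), and $l(v)$ denotes the number of leaves of $T(v)$ (so $l(v)=1$ iff $v$ is a leaf). Let $\mathbb{T}_n=\{T\in\mathbb{T}: l(\mathrm{root}(T))=n\}$. For trees $T_1,T_2\in\mathbb{T}$, $T_1\equiv T_2$ means they are isomorphic as rooted trees (one can be turned into the other by permuting siblings). For an integer $p\ge 2$, $\mathrm{Part}(p)$ is the set of non-decreasing sequences $(a_1,\dots,a_k)$ of positive integers with $k\ge 2$ and $\sum_i a_i=p$, ordered lexicographically: for distinct $a=(a_i)_k$, $b=(b_i)_m$, let $j$ be the least index $\le\min\{k,m\}$ with $a_j\ne b_j$; then $a<b$ iff $a_j<b_j$. Node comparison: define, by induction on the number of leaves, a comparison between nodes $v,w$ (of the same or of different trees of $\mathbb{T}$) with outcomes $v<w$, $v\sim w$, or $w<v$: (1) if $l(v)<l(w)$ then $v<w$ (and if $l(w)<l(v)$ then $w<v$); (2) if $l(v)=l(w)=1$ then $v\sim w$; (3) if $l(v)=l(w)\ge 2$, list the children of $v$ as $v_1,\dots,v_k$ and those of $w$ as $w_1,\dots,w_m$, each list non-decreasing with respect to this comparison (already defined for them since they have fewer leaves); these lists are non-decreasing in $l$, and $(l(v_1),\dots,l(v_k))$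 and $(l(w_1),\dots,l(w_m))$ are elements of $\mathrm{Part}(l(v))$, called the partitions induced by $v$ and $w$. (3.1) If the partition induced by $v$ is lexicographically smaller than the one induced by $w$, then $v<w$; if it is larger, then $w<v$. (3.2) If they are equal (so $k=m$): if $v_i\sim w_i$ for all $i$ then $v\sim w$; otherwise, with $j$ the least index such that $v_j\not\sim w_j$, we have $v<w$ if $v_j<w_j$ and $w<v$ otherwise. -}

module Defs where

open import Data.Nat using (ℕ; zero; suc; _+_; _≤_; _<ᵇ_)
open import Data.Bool using (if_then_else_)
open import Data.List using (List; []; _∷_; length; lookup; map)
open import Data.List.Relation.Unary.All using (All)
open import Data.Fin using (Fin)
open import Function.Bundles using (_↔_; Inverse)
open import Relation.Binary.PropositionalEquality using (_≡_)

-- Finite rooted (plane) trees; siblings are listed in some order, which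
-- is forgotten by the isomorphism relation _≅_ below.
data Tree : Set where
  leaf : Tree
  node : List Tree → Tree

data Valid : Tree → Set where
  leafV : Valid leaf
  nodeV : ∀ {ts} → 2 ≤ length ts → All Valid ts → Valid (node ts)

mutual
  leaves : Tree → ℕ
  leaves leaf = 1
  leaves (node ts) = leavesL ts

  leavesL : List Tree → ℕ
  leavesL [] = 0
  leavesL (t ∷ ts) = leaves t + leavesL ts

mutual
  size : Tree → ℕ
  size leaf = 1
  size (node ts) = suc (sizeL ts)

  sizeL : List Tree → ℕ
  sizeL [] = 0
  sizeL (t ∷ ts) = size t + sizeL ts

-- Nodes of a tree, as positions (paths from the root).
data Node : Tree → Set where
  here  : ∀ {t} → Node t
  there : ∀ {ts} (i : Fin (length ts)) → Node (lookup ts i) → Node (node ts)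

subtree : ∀ {t} → Node t → Tree
subtree {t} here = t
subtree (there {ts} i p) = subtree p

data _≅_ : Tree → Tree → Set where
  leaf≅ : leaf ≅ leaf
  node≅ : ∀ {ts us} (π : Fin (length ts) ↔ Fin (length us)) →
          (∀ i → lookup ts i ≅ lookup us (Inverse.to π i)) →
          node ts ≅ node us

data Ord : Set where
  lt eq gt : Ord

compareℕ : ℕ → ℕ → Ord
compareℕ m n = if m <ᵇ n then lt else (if n <ᵇ m then gt else eq)

lexWith : {A : Set} → (A → A → Ord) → List A → List A → Ord
lexWith c [] [] = eq
lexWith c [] (_ ∷ _) = lt
lexWith c (_ ∷ _) [] = gt
lexWith c (x ∷ xs) (y ∷ ys) with c x y
... | lt = lt
... | gt = gt
... | eq = lexWith c xs ys

insertBy : {A : Set} → (A → A → Ord) → A → List A → List A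
insertBy c x [] = x ∷ []
insertBy c x (y ∷ ys) with c x y
... | gt = y ∷ insertBy c x ys
... | _  = x ∷ y ∷ ys

sortBy : {A : Set} → (A → A → Ord) → List A → List A
sortBy c [] = []
sortBy c (x ∷ xs) = insertBy c x (sortBy c xs)

cmpF : ℕ → Tree → Tree → Ord
cmpF zero _ _ = eq
cmpF (suc k) v w with compareℕ (leaves v) (leaves w)
... | lt = lt
... | gt = gt
... | eq = step v w
  where
  children : Tree → List Tree
  children leaf = []
  children (node ts) = sortBy (cmpF k) ts

  step : Tree → Tree → Ord
  step leaf leaf = eq
  step _ _ with lexWith compareℕ (map leaves (children v)) (map leaves (children w))
  ... | lt = lt
  ... | gt = gt
  ... | eq = lexWith (cmpF k) (children v) (children w)

cmpTree : Tree → Tree → Ord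
cmpTree v w = cmpF (size v + size w) v w

cmpNode : ∀ {T} → Node T → Node T → Ord
cmpNode v w = cmpTree (subtree v) (subtree w)

_∼_ : ∀ {T} → Node T → Node T → Set
v ∼ w = cmpNode v w ≡ eq

-- By induction on a bound k for the number of nodes: on trees with at most k nodes, cmpF k is
-- a total preorder whose ties are exactly the isomorphisms. For the step, insertion sort by such
-- a preorder sends lists that are permutations of each other up to isomorphism to pointwise
-- isomorphic lists, so the sorted child list is a canonical form of the children; hence two
-- trees tie at fuel k + 1 iff their sorted children tie pointwise iff the trees are isomorphic.
-- The fuel size x + size y used by cmpTree bounds the sizes of both arguments.
module Submission where

open import Data.Fin using (Fin; zero; suc; punchIn)
open import Data.Fin.Permutation as Permutation using (Permutation; _⟨$⟩ʳ_; _⟨$⟩ˡ_; inverseʳ; remove)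
open import Data.Fin.Properties using (punchIn-punchOut)
open import Data.List using (List; []; _∷_; map; tabulate; lookup; length)
open import Data.List.Properties using (tabulate-lookup)
open import Data.List.Relation.Binary.Pointwise as Pointwise using (Pointwise; []; _∷_)
import Data.List.Relation.Binary.Permutation.Propositional as PropPerm
import Data.List.Relation.Binary.Permutation.Setoid as SetoidPerm
import Data.List.Relation.Binary.Permutation.Setoid.Properties as SetoidPermProps
open import Data.List.Relation.Unary.All as All using (All; []; _∷_)
open import Data.Nat using (ℕ; zero; suc; _+_; _≤_; s≤s)
open import Data.Nat.ListAction using (sum)
open import Data.Nat.ListAction.Properties using (sum-↭)
open import Data.Nat.Properties using (m+n≤o⇒m≤o; m+n≤o⇒n≤o; m≤m+n; m≤n+m)
open import Data.Product using (_×_; _,_; proj₂)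
open import Data.Sum using (_⊎_; inj₁; inj₂)
open import Data.Unit using (⊤; tt)
open import Data.Empty using (⊥-elim)
open import Function.Bundles using (_⇔_; mk⇔; _↔_; Inverse)
open import Level using (0ℓ)
open import Relation.Binary.Bundles using (Setoid)
import Relation.Binary.Construct.On as On
open import Relation.Binary.PropositionalEquality
open import Relation.Nullary using (¬_)

open import Defs

opposite : Ord → Ord
opposite lt = gt
opposite eq = eq
opposite gt = lt

infixr 5 _then_

_then_ : Ord → Ord → Ord
lt then _ = lt
eq then o = o
gt then _ = gt

opposite-then : ∀ a b → opposite a then opposite b ≡ opposite (a then b)
opposite-then lt b = refl
opposite-then eq b = refl
opposite-then gt b = refl

then-lt : ∀ {a b} → a then b ≡ lt → a ≡ lt ⊎ (a ≡ eq × b ≡ lt)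
then-lt {lt} _ = inj₁ refl
then-lt {eq} b≡lt = inj₂ (refl , b≡lt)

then-eq : ∀ {a b} → a then b ≡ eq → a ≡ eq × b ≡ eq
then-eq {eq} b≡eq = refl , b≡eq

then-eq⁺ : ∀ {a b} → a ≡ eq → b ≡ eq → a then b ≡ eq
then-eq⁺ refl refl = refl

gt-or-le : ∀ o → o ≡ gt ⊎ (o ≡ lt ⊎ o ≡ eq)
gt-or-le lt = inj₂ (inj₁ refl)
gt-or-le eq = inj₂ (inj₂ refl)
gt-or-le gt = inj₁ refl

-- Total preorders presented as comparison functions

record IsComparison {A : Set} (P : A → Set) (c : A → A → Ord) : Set where
  field
    antisym   : ∀ {x y} → P x → P y → c y x ≡ opposite (c x y)
    lt-trans  : ∀ {x y z} → P x → P y → P z → c x y ≡ lt → c y z ≡ lt → c x z ≡ lt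
    eq-substˡ : ∀ {x y z} → P x → P y → P z → c x y ≡ eq → c x z ≡ c y z

  eq-substʳ : ∀ {x y z} → P x → P y → P z → c y z ≡ eq → c x y ≡ c x z
  eq-substʳ {x} {y} {z} px py pz y≈z = begin
    c x y              ≡⟨ antisym py px ⟩
    opposite (c y x)   ≡⟨ cong opposite (eq-substˡ py pz px y≈z) ⟩
    opposite (c z x)   ≡⟨ antisym pz px ⟨
    c x z              ∎
    where open ≡-Reasoning

  gt-le-trans : ∀ {x y z} → P x → P y → P z → c x z ≡ gt → c y z ≡ lt ⊎ c y z ≡ eq → c x y ≡ gt
  gt-le-trans {x} {y} {z} px py pz x>z (inj₁ y<z) =
    trans (antisym py px) (cong opposite (lt-trans py pz px y<z (trans (antisym px pz) (cong opposite x>z))))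
  gt-le-trans {x} {y} {z} px py pz x>z (inj₂ y≈z) =
    trans (antisym py px)
          (cong opposite (trans (eq-substˡ py pz px y≈z) (trans (antisym px pz) (cong opposite x>z))))

open IsComparison

compareℕ-antisym : ∀ m n → compareℕ n m ≡ opposite (compareℕ m n)
compareℕ-antisym zero    zero    = refl
compareℕ-antisym zero    (suc n) = refl
compareℕ-antisym (suc m) zero    = refl
compareℕ-antisym (suc m) (suc n) = compareℕ-antisym m n

compareℕ-lt-trans : ∀ x y z → compareℕ x y ≡ lt → compareℕ y z ≡ lt → compareℕ x z ≡ lt
compareℕ-lt-trans zero    (suc y) (suc z) _ _ = refl
compareℕ-lt-trans (suc x) (suc y) (suc z) x<y y<z = compareℕ-lt-trans x y z x<y y<z

compareℕ-eq⁻ : ∀ {m n} → compareℕ m n ≡ eq → m ≡ n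
compareℕ-eq⁻ {zero}  {zero}  _   = refl
compareℕ-eq⁻ {suc m} {suc n} m≈n = cong suc (compareℕ-eq⁻ m≈n)

compareℕ-eq⁺ : ∀ {m n} → m ≡ n → compareℕ m n ≡ eq
compareℕ-eq⁺ {zero}  refl = refl
compareℕ-eq⁺ {suc m} refl = compareℕ-eq⁺ {m} refl

compareℕ-isComparison : ∀ {P : ℕ → Set} → IsComparison P compareℕ
compareℕ-isComparison = record
  { antisym   = λ {x} {y} _ _ → compareℕ-antisym x y
  ; lt-trans  = λ {x} {y} {z} _ _ _ → compareℕ-lt-trans x y z
  ; eq-substˡ = λ {x} {y} {z} _ _ _ x≈y → cong (λ m → compareℕ m z) (compareℕ-eq⁻ x≈y)
  }

module _ {A : Set} {P : A → Set} {c₁ c₂ : A → A → Ord}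
         (isC₁ : IsComparison P c₁) (isC₂ : IsComparison P c₂) where

  then-isComparison : IsComparison P (λ x y → c₁ x y then c₂ x y)
  antisym then-isComparison {x} {y} px py
    rewrite antisym isC₁ px py | antisym isC₂ px py = opposite-then (c₁ x y) (c₂ x y)
  lt-trans then-isComparison px py pz xy yz with then-lt xy | then-lt yz
  ... | inj₁ x<y        | inj₁ y<z        rewrite lt-trans isC₁ px py pz x<y y<z = refl
  ... | inj₁ x<y        | inj₂ (y≈z , _)  rewrite eq-substʳ isC₁ px py pz y≈z | x<y = refl
  ... | inj₂ (x≈y , _)  | inj₁ y<z        rewrite eq-substˡ isC₁ px py pz x≈y | y<z = refl
  ... | inj₂ (x≈y , x<y) | inj₂ (y≈z , y<z)
    rewrite eq-substˡ isC₁ px py pz x≈y | y≈z | lt-trans isC₂ px py pz x<y y<z = refl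
  eq-substˡ then-isComparison px py pz xy with then-eq xy
  ... | x≈y , x≈′y rewrite eq-substˡ isC₁ px py pz x≈y | eq-substˡ isC₂ px py pz x≈′y = refl

isComparison-ext : ∀ {A : Set} {P : A → Set} {c c′ : A → A → Ord} → IsComparison P c →
                   (∀ {x y} → P x → P y → c′ x y ≡ c x y) → IsComparison P c′
antisym (isComparison-ext isC c′≗c) px py =
  trans (c′≗c py px) (trans (antisym isC px py) (cong opposite (sym (c′≗c px py))))
lt-trans (isComparison-ext isC c′≗c) px py pz xy yz =
  trans (c′≗c px pz) (lt-trans isC px py pz (trans (sym (c′≗c px py)) xy) (trans (sym (c′≗c py pz)) yz))
eq-substˡ (isComparison-ext isC c′≗c) px py pz xy =
  trans (c′≗c px pz) (trans (eq-substˡ isC px py pz (trans (sym (c′≗c px py)) xy)) (sym (c′≗c py pz)))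

isComparison-on : ∀ {A B : Set} {P : A → Set} {Q : B → Set} {c : A → A → Ord} → IsComparison P c →
                  (f : B → A) → (∀ {b} → Q b → P (f b)) → IsComparison Q (λ a b → c (f a) (f b))
antisym   (isComparison-on isC f pf) qx qy    = antisym isC (pf qx) (pf qy)
lt-trans  (isComparison-on isC f pf) qx qy qz = lt-trans isC (pf qx) (pf qy) (pf qz)
eq-substˡ (isComparison-on isC f pf) qx qy qz = eq-substˡ isC (pf qx) (pf qy) (pf qz)

-- Lexicographic comparison

lexWith-∷ : ∀ {A : Set} (c : A → A → Ord) x y xs ys →
            lexWith c (x ∷ xs) (y ∷ ys) ≡ c x y then lexWith c xs ys
lexWith-∷ c x y xs ys with c x y
... | lt = refl
... | eq = refl
... | gt = refl

module _ {A : Set} (c : A → A → Ord) where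

  lexWith-eq⁻ : ∀ {xs ys} → lexWith c xs ys ≡ eq → Pointwise (λ a b → c a b ≡ eq) xs ys
  lexWith-eq⁻ {[]}     {[]}     _ = []
  lexWith-eq⁻ {x ∷ xs} {y ∷ ys} e with then-eq (trans (sym (lexWith-∷ c x y xs ys)) e)
  ... | x≈y , xs≈ys = x≈y ∷ lexWith-eq⁻ xs≈ys

  lexWith-eq⁺ : ∀ {xs ys} → Pointwise (λ a b → c a b ≡ eq) xs ys → lexWith c xs ys ≡ eq
  lexWith-eq⁺ [] = refl
  lexWith-eq⁺ {x ∷ xs} {y ∷ ys} (x≈y ∷ xs≈ys)
    rewrite lexWith-∷ c x y xs ys | x≈y = lexWith-eq⁺ xs≈ys

lexWith-[]-insertBy : ∀ {A : Set} (c′ c : A → A → Ord) x l → lexWith c′ [] (insertBy c x l) ≡ lt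
lexWith-[]-insertBy c′ c x []      = refl
lexWith-[]-insertBy c′ c x (y ∷ l) with c x y
... | lt = refl
... | eq = refl
... | gt = refl

lexWith-insertBy-[] : ∀ {A : Set} (c′ c : A → A → Ord) x l → lexWith c′ (insertBy c x l) [] ≡ gt
lexWith-insertBy-[] c′ c x []      = refl
lexWith-insertBy-[] c′ c x (y ∷ l) with c x y
... | lt = refl
... | eq = refl
... | gt = refl

module _ {A : Set} {P : A → Set} {c : A → A → Ord} (isC : IsComparison P c) where

  lexWith-antisym : ∀ {xs ys} → All P xs → All P ys → lexWith c ys xs ≡ opposite (lexWith c xs ys)
  lexWith-antisym [] [] = refl
  lexWith-antisym [] (_ ∷ _) = refl
  lexWith-antisym (_ ∷ _) [] = refl
  lexWith-antisym {x ∷ xs} {y ∷ ys} (px ∷ pxs) (py ∷ pys)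
    rewrite lexWith-∷ c y x ys xs | lexWith-∷ c x y xs ys | antisym isC px py | lexWith-antisym pxs pys
    = opposite-then (c x y) (lexWith c xs ys)

  lexWith-lt-trans : ∀ {xs ys zs} → All P xs → All P ys → All P zs →
                     lexWith c xs ys ≡ lt → lexWith c ys zs ≡ lt → lexWith c xs zs ≡ lt
  lexWith-lt-trans [] (_ ∷ _) (_ ∷ _) _ _ = refl
  lexWith-lt-trans _ (_ ∷ _) [] _ ()
  lexWith-lt-trans {x ∷ xs} {y ∷ ys} {z ∷ zs} (px ∷ pxs) (py ∷ pys) (pz ∷ pzs) xy yz
    rewrite lexWith-∷ c x z xs zs
    with then-lt (trans (sym (lexWith-∷ c x y xs ys)) xy) | then-lt (trans (sym (lexWith-∷ c y z ys zs)) yz)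
  ... | inj₁ x<y         | inj₁ y<z         rewrite lt-trans isC px py pz x<y y<z = refl
  ... | inj₁ x<y         | inj₂ (y≈z , _)   rewrite eq-substʳ isC px py pz y≈z | x<y = refl
  ... | inj₂ (x≈y , _)   | inj₁ y<z         rewrite eq-substˡ isC px py pz x≈y | y<z = refl
  ... | inj₂ (x≈y , xs<ys) | inj₂ (y≈z , ys<zs)
    rewrite eq-substˡ isC px py pz x≈y | y≈z = lexWith-lt-trans pxs pys pzs xs<ys ys<zs

  lexWith-eq-substˡ : ∀ {xs ys zs} → All P xs → All P ys → All P zs →
                      lexWith c xs ys ≡ eq → lexWith c xs zs ≡ lexWith c ys zs
  lexWith-eq-substˡ [] [] _ _ = refl
  lexWith-eq-substˡ (_ ∷ _) (_ ∷ _) [] _ = refl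
  lexWith-eq-substˡ {x ∷ xs} {y ∷ ys} {z ∷ zs} (px ∷ pxs) (py ∷ pys) (pz ∷ pzs) xy
    rewrite lexWith-∷ c x z xs zs | lexWith-∷ c y z ys zs
    with then-eq (trans (sym (lexWith-∷ c x y xs ys)) xy)
  ... | x≈y , xs≈ys rewrite eq-substˡ isC px py pz x≈y | lexWith-eq-substˡ pxs pys pzs xs≈ys = refl

  lexWith-isComparison : IsComparison (All P) (lexWith c)
  lexWith-isComparison = record
    { antisym = lexWith-antisym ; lt-trans = lexWith-lt-trans ; eq-substˡ = lexWith-eq-substˡ }

-- Permutations given by a bijection of indices

module _ (S : Setoid 0ℓ 0ℓ) where
  open Setoid S using (_≈_) renaming (Carrier to A)
  open SetoidPerm S

  tabulate-↭-pick : ∀ {n} (g : Fin (suc n) → A) (j : Fin (suc n)) →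
                    tabulate g ↭ g j ∷ tabulate (λ i → g (punchIn j i))
  tabulate-↭-pick g zero = ↭-refl
  tabulate-↭-pick {suc n} g (suc j) =
    ↭-trans (↭-prep (g zero) (tabulate-↭-pick (λ i → g (suc i)) j)) (↭-swap (g zero) (g (suc j)) ↭-refl)

  tabulate-↭ : ∀ {m n} (f : Fin m → A) (g : Fin n → A) (π : Permutation m n) →
               (∀ i → f i ≈ g (π ⟨$⟩ʳ i)) → tabulate f ↭ tabulate g
  tabulate-↭ {zero}  {zero}  f g π f≈g = ↭-refl
  tabulate-↭ {zero}  {suc n} f g π f≈g with π ⟨$⟩ˡ zero
  ... | ()
  tabulate-↭ {suc m} {zero}  f g π f≈g with π ⟨$⟩ʳ zero
  ... | ()
  tabulate-↭ {suc m} {suc n} f g π f≈g =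
    ↭-trans (prep (f≈g zero) rest) (↭-sym (tabulate-↭-pick g (π ⟨$⟩ʳ zero)))
    where
    rest : tabulate (λ i → f (suc i)) ↭ tabulate (λ i → g (punchIn (π ⟨$⟩ʳ zero) i))
    rest = tabulate-↭ (λ i → f (suc i)) (λ i → g (punchIn (π ⟨$⟩ʳ zero) i)) (remove zero π)
             (λ i → subst (λ k → f (suc i) ≈ g k) (sym (punchIn-punchOut _)) (f≈g (suc i)))

  ↔⇒↭ : ∀ (xs ys : List A) (π : Fin (length xs) ↔ Fin (length ys)) →
        (∀ i → lookup xs i ≈ lookup ys (Inverse.to π i)) → xs ↭ ys
  ↔⇒↭ xs ys π xs≈ys =
    subst₂ _↭_ (tabulate-lookup xs) (tabulate-lookup ys) (tabulate-↭ (lookup xs) (lookup ys) π xs≈ys)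

sum-map-↔ : ∀ {A : Set} (h : A → ℕ) (xs ys : List A) (π : Fin (length xs) ↔ Fin (length ys)) →
            (∀ i → h (lookup xs i) ≡ h (lookup ys (Inverse.to π i))) → sum (map h xs) ≡ sum (map h ys)
sum-map-↔ h xs ys π h≡ =
  sum-↭ (PropPerm.↭ₛ⇒↭ (SetoidPermProps.map⁺ S ℕₛ (λ e → e) (↔⇒↭ S xs ys π h≡)))
  where
  ℕₛ = setoid ℕ
  S = On.setoid ℕₛ h

-- Tree isomorphism

mutual
  ≅-refl : ∀ t → t ≅ t
  ≅-refl leaf      = leaf≅
  ≅-refl (node ts) = node≅ Permutation.id (≅-refl-lookup ts)

  ≅-refl-lookup : ∀ ts (i : Fin (length ts)) → lookup ts i ≅ lookup ts i
  ≅-refl-lookup (t ∷ ts) zero    = ≅-refl t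
  ≅-refl-lookup (t ∷ ts) (suc i) = ≅-refl-lookup ts i

≅-sym : ∀ {t u} → t ≅ u → u ≅ t
≅-sym leaf≅ = leaf≅
≅-sym (node≅ {ts} {us} π f) =
  node≅ (Permutation.flip π)
        (λ j → subst (λ k → lookup us k ≅ lookup ts (π ⟨$⟩ˡ j)) (inverseʳ π) (≅-sym (f (π ⟨$⟩ˡ j))))

≅-trans : ∀ {t u s} → t ≅ u → u ≅ s → t ≅ s
≅-trans leaf≅ leaf≅ = leaf≅
≅-trans (node≅ π f) (node≅ ρ g) = node≅ (π Permutation.∘ₚ ρ) (λ i → ≅-trans (f i) (g (π ⟨$⟩ʳ i)))

≅-setoid : Setoid 0ℓ 0ℓ
≅-setoid = record
  { Carrier = Tree ; _≈_ = _≅_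
  ; isEquivalence = record { refl = ≅-refl _ ; sym = ≅-sym ; trans = ≅-trans } }

sizeL≡sum : ∀ ts → sizeL ts ≡ sum (map size ts)
sizeL≡sum []       = refl
sizeL≡sum (t ∷ ts) = cong (size t +_) (sizeL≡sum ts)

leavesL≡sum : ∀ ts → leavesL ts ≡ sum (map leaves ts)
leavesL≡sum []       = refl
leavesL≡sum (t ∷ ts) = cong (leaves t +_) (leavesL≡sum ts)

size-resp-≅ : ∀ {t u} → t ≅ u → size t ≡ size u
size-resp-≅ leaf≅ = refl
size-resp-≅ (node≅ {ts} {us} π f) = cong suc (begin
  sizeL ts             ≡⟨ sizeL≡sum ts ⟩
  sum (map size ts)    ≡⟨ sum-map-↔ size ts us π (λ i → size-resp-≅ (f i)) ⟩
  sum (map size us)    ≡⟨ sizeL≡sum us ⟨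
  sizeL us             ∎)
  where open ≡-Reasoning

leaves-resp-≅ : ∀ {t u} → t ≅ u → leaves t ≡ leaves u
leaves-resp-≅ leaf≅ = refl
leaves-resp-≅ (node≅ {ts} {us} π f) = begin
  leavesL ts           ≡⟨ leavesL≡sum ts ⟩
  sum (map leaves ts)  ≡⟨ sum-map-↔ leaves ts us π (λ i → leaves-resp-≅ (f i)) ⟩
  sum (map leaves us)  ≡⟨ leavesL≡sum us ⟨
  leavesL us           ∎
  where open ≡-Reasoning

-- Insertion sort

module InsertionSort (S : Setoid 0ℓ 0ℓ) {P : Setoid.Carrier S → Set}
  (c : Setoid.Carrier S → Setoid.Carrier S → Ord) (isC : IsComparison P c)
  (eq⇒≈ : ∀ {x y} → P x → P y → c x y ≡ eq → Setoid._≈_ S x y)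
  (≈⇒eq : ∀ {x y} → P x → P y → Setoid._≈_ S x y → c x y ≡ eq)
  (P-resp-≈ : ∀ {x y} → Setoid._≈_ S x y → P x → P y) where

  open Setoid S using (_≈_) renaming (Carrier to A; refl to ≈-refl; sym to ≈-sym)
  open import Data.List.Relation.Binary.Equality.Setoid S using (_≋_; ≋-refl; ≋-trans)
  module ↭ = SetoidPerm S
  open ↭ hiding (refl; trans)
  open SetoidPermProps S using (All-resp-↭)

  insert : A → List A → List A
  insert = insertBy c

  sort : List A → List A
  sort = sortBy c

  insert-gt : ∀ {x y} l → c x y ≡ gt → insert x (y ∷ l) ≡ y ∷ insert x l
  insert-gt l x>y rewrite x>y = refl

  insert-le : ∀ {x y} l → c x y ≡ lt ⊎ c x y ≡ eq → insert x (y ∷ l) ≡ x ∷ y ∷ l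
  insert-le l (inj₁ x<y) rewrite x<y = refl
  insert-le l (inj₂ x≈y) rewrite x≈y = refl

  All-insert : ∀ {x l} → P x → All P l → All P (insert x l)
  All-insert px [] = px ∷ []
  All-insert {x} {y ∷ l} px (py ∷ pl) with gt-or-le (c x y)
  ... | inj₁ x>y rewrite insert-gt l x>y = py ∷ All-insert px pl
  ... | inj₂ x≤y rewrite insert-le l x≤y = px ∷ py ∷ pl

  All-sort : ∀ {l} → All P l → All P (sort l)
  All-sort []        = []
  All-sort (px ∷ pl) = All-insert px (All-sort pl)

  insert-↭ : ∀ x l → insert x l ↭ x ∷ l
  insert-↭ x [] = ↭-refl
  insert-↭ x (y ∷ l) with gt-or-le (c x y)
  ... | inj₁ x>y rewrite insert-gt l x>y = ↭-trans (↭-prep y (insert-↭ x l)) (↭-swap y x ↭-refl)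
  ... | inj₂ x≤y rewrite insert-le l x≤y = ↭-refl

  sort-↭ : ∀ l → sort l ↭ l
  sort-↭ []      = ↭-refl
  sort-↭ (x ∷ l) = ↭-trans (insert-↭ x (sort l)) (↭-prep x (sort-↭ l))

  c-resp-≈ : ∀ {x x′ y y′} → P x → P x′ → P y → P y′ → x ≈ x′ → y ≈ y′ → c x y ≡ c x′ y′
  c-resp-≈ px px′ py py′ x≈x′ y≈y′ =
    trans (eq-substˡ isC px px′ py (≈⇒eq px px′ x≈x′)) (eq-substʳ isC px′ py py′ (≈⇒eq py py′ y≈y′))

  insert-cong : ∀ {x x′ l l′} → P x → P x′ → All P l → All P l′ → x ≈ x′ → l ≋ l′ →
                insert x l ≋ insert x′ l′
  insert-cong px px′ [] [] x≈x′ [] = x≈x′ ∷ []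
  insert-cong {x} {x′} {y ∷ l} {y′ ∷ l′} px px′ (py ∷ pl) (py′ ∷ pl′) x≈x′ (y≈y′ ∷ l≋l′)
    with c-resp-≈ px px′ py py′ x≈x′ y≈y′ | gt-or-le (c x y)
  ... | same | inj₁ x>y rewrite insert-gt l x>y | insert-gt l′ (trans (sym same) x>y) =
    y≈y′ ∷ insert-cong px px′ pl pl′ x≈x′ l≋l′
  ... | same | inj₂ (inj₁ x<y) rewrite insert-le l (inj₁ x<y) | insert-le l′ (inj₁ (trans (sym same) x<y)) =
    x≈x′ ∷ y≈y′ ∷ l≋l′
  ... | same | inj₂ (inj₂ x≈y) rewrite insert-le l (inj₂ x≈y) | insert-le l′ (inj₂ (trans (sym same) x≈y)) =
    x≈x′ ∷ y≈y′ ∷ l≋l′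

  insert-swap-front : ∀ {x y} l → P x → P y → insert x l ≡ x ∷ l → insert y l ≡ y ∷ l →
                      insert x (y ∷ l) ≋ insert y (x ∷ l)
  insert-swap-front {x} {y} l px py x-front y-front with gt-or-le (c x y)
  ... | inj₁ x>y
    rewrite insert-gt l x>y | x-front | insert-le l (inj₁ (trans (antisym isC px py) (cong opposite x>y))) =
    ≋-refl
  ... | inj₂ (inj₁ x<y)
    rewrite insert-le l (inj₁ x<y) | insert-gt l (trans (antisym isC px py) (cong opposite x<y)) | y-front =
    ≋-refl
  ... | inj₂ (inj₂ x≈y)
    rewrite insert-le l (inj₂ x≈y) | insert-le l (inj₂ (trans (antisym isC px py) (cong opposite x≈y))) =
    eq⇒≈ px py x≈y ∷ ≈-sym (eq⇒≈ px py x≈y) ∷ ≋-refl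

  insert-swap : ∀ {x y l} → P x → P y → All P l → insert x (insert y l) ≋ insert y (insert x l)
  insert-swap {x} {y} {[]} px py [] = insert-swap-front [] px py refl refl
  insert-swap {x} {y} {z ∷ l} px py (pz ∷ pl) with gt-or-le (c x z) | gt-or-le (c y z)
  ... | inj₂ x≤z | inj₂ y≤z rewrite insert-le l y≤z | insert-le l x≤z =
    insert-swap-front (z ∷ l) px py (insert-le l x≤z) (insert-le l y≤z)
  ... | inj₁ x>z | inj₂ y≤z
    rewrite insert-le l y≤z | insert-gt l x>z | insert-gt (z ∷ l) (gt-le-trans isC px py pz x>z y≤z)
          | insert-gt l x>z | insert-le (insert x l) y≤z = ≋-refl
  ... | inj₂ x≤z | inj₁ y>z
    rewrite insert-gt l y>z | insert-le l x≤z | insert-gt (z ∷ l) (gt-le-trans isC py px pz y>z x≤z)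
          | insert-gt l y>z | insert-le (insert y l) x≤z = ≋-refl
  ... | inj₁ x>z | inj₁ y>z
    rewrite insert-gt l y>z | insert-gt l x>z | insert-gt (insert y l) x>z | insert-gt (insert x l) y>z =
    ≈-refl ∷ insert-swap px py pl

  sort-cong : ∀ {xs ys} → All P xs → All P ys → xs ≋ ys → sort xs ≋ sort ys
  sort-cong [] [] [] = []
  sort-cong (px ∷ pxs) (py ∷ pys) (x≈y ∷ xs≋ys) =
    insert-cong px py (All-sort pxs) (All-sort pys) x≈y (sort-cong pxs pys xs≋ys)

  sort-↭⇒≋ : ∀ {xs ys} → All P xs → All P ys → xs ↭ ys → sort xs ≋ sort ys
  sort-↭⇒≋ pxs pys (↭.refl xs≋ys) = sort-cong pxs pys xs≋ys
  sort-↭⇒≋ (px ∷ pxs) (py ∷ pys) (prep x≈y xs↭ys) =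
    insert-cong px py (All-sort pxs) (All-sort pys) x≈y (sort-↭⇒≋ pxs pys xs↭ys)
  sort-↭⇒≋ (px ∷ py ∷ pxs) (py′ ∷ px′ ∷ pys) (swap x≈x′ y≈y′ xs↭ys) =
    ≋-trans (insert-swap px py (All-sort pxs))
      (insert-cong py py′ (All-insert px (All-sort pxs)) (All-insert px′ (All-sort pys)) y≈y′
        (insert-cong px px′ (All-sort pxs) (All-sort pys) x≈x′ (sort-↭⇒≋ pxs pys xs↭ys)))
  sort-↭⇒≋ pxs pzs (↭.trans xs↭ys ys↭zs) =
    ≋-trans (sort-↭⇒≋ pxs pys xs↭ys) (sort-↭⇒≋ pys pzs ys↭zs)
    where pys = All-resp-↭ P-resp-≈ xs↭ys pxs

-- The node comparison

Pointwise-mapWithAll : ∀ {A : Set} {P : A → Set} {R S : A → A → Set} →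
                       (∀ {x y} → P x → P y → R x y → S x y) →
                       ∀ {xs ys} → All P xs → All P ys → Pointwise R xs ys → Pointwise S xs ys
Pointwise-mapWithAll f [] [] [] = []
Pointwise-mapWithAll f (px ∷ pxs) (py ∷ pys) (r ∷ rs) = f px py r ∷ Pointwise-mapWithAll f pxs pys rs

sortedChildren : ℕ → Tree → List Tree
sortedChildren k leaf      = []
sortedChildren k (node ts) = sortBy (cmpF k) ts

partition : ℕ → Tree → List ℕ
partition k t = map leaves (sortedChildren k t)

-- The special clause for two leaves agrees with the general one, as both child lists are empty.
cmpF-suc : ∀ k x y → cmpF (suc k) x y ≡
           compareℕ (leaves x) (leaves y)
             then lexWith compareℕ (partition k x) (partition k y)
             then lexWith (cmpF k) (sortedChildren k x) (sortedChildren k y)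
cmpF-suc k x y with compareℕ (leaves x) (leaves y)
... | lt = refl
... | gt = refl
cmpF-suc k leaf leaf | eq = refl
cmpF-suc k leaf (node us) | eq with lexWith compareℕ [] (partition k (node us))
... | lt = refl
... | gt = refl
... | eq = refl
cmpF-suc k (node ts) leaf | eq with lexWith compareℕ (partition k (node ts)) []
... | lt = refl
... | gt = refl
... | eq = refl
cmpF-suc k (node ts) (node us) | eq with lexWith compareℕ (partition k (node ts)) (partition k (node us))
... | lt = refl
... | gt = refl
... | eq = refl

SizeAtMost : ℕ → Tree → Set
SizeAtMost k t = size t ≤ k

All-SizeAtMost : ∀ {k} ts → sizeL ts ≤ k → All (SizeAtMost k) ts
All-SizeAtMost []       _  = []
All-SizeAtMost (t ∷ ts) le = m+n≤o⇒m≤o (size t) le ∷ All-SizeAtMost ts (m+n≤o⇒n≤o (size t) le)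

record Canonical (k : ℕ) : Set where
  field
    isComparison : IsComparison (SizeAtMost k) (cmpF k)
    eq⇒≅ : ∀ {x y} → SizeAtMost k x → SizeAtMost k y → cmpF k x y ≡ eq → x ≅ y
    ≅⇒eq : ∀ {x y} → SizeAtMost k x → SizeAtMost k y → x ≅ y → cmpF k x y ≡ eq

¬SizeAtMost-zero : ∀ {t} → ¬ SizeAtMost 0 t
¬SizeAtMost-zero {leaf}   ()
¬SizeAtMost-zero {node _} ()

canonical-zero : Canonical 0
canonical-zero = record
  { isComparison = record
    { antisym   = λ t≤0 _ → ⊥-elim (¬SizeAtMost-zero t≤0)
    ; lt-trans  = λ t≤0 _ _ _ _ → ⊥-elim (¬SizeAtMost-zero t≤0)
    ; eq-substˡ = λ t≤0 _ _ _ → ⊥-elim (¬SizeAtMost-zero t≤0) }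
  ; eq⇒≅ = λ t≤0 _ _ → ⊥-elim (¬SizeAtMost-zero t≤0)
  ; ≅⇒eq = λ t≤0 _ _ → ⊥-elim (¬SizeAtMost-zero t≤0)
  }

canonical-suc : ∀ {k} → Canonical k → Canonical (suc k)
canonical-suc {k} canon = record
  { isComparison = isComparison-suc ; eq⇒≅ = eq⇒≅-suc ; ≅⇒eq = ≅⇒eq-suc }
  where
  open Canonical canon
  open InsertionSort ≅-setoid (cmpF k) isComparison eq⇒≅ ≅⇒eq
    (λ x≅y x≤k → subst (_≤ k) (size-resp-≅ x≅y) x≤k)
  open SetoidPerm ≅-setoid using (_↭_; ↭-sym; ↭-trans; ↭-reflexive-≋; onIndices)
  open SetoidPermProps ≅-setoid using (onIndices-lookup)

  sortedChildren-SizeAtMost : ∀ {x} → SizeAtMost (suc k) x → All (SizeAtMost k) (sortedChildren k x)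
  sortedChildren-SizeAtMost {leaf}    _          = []
  sortedChildren-SizeAtMost {node ts} (s≤s ts≤k) = All-sort (All-SizeAtMost ts ts≤k)

  isComparison-suc : IsComparison (SizeAtMost (suc k)) (cmpF (suc k))
  isComparison-suc = isComparison-ext
    (then-isComparison (isComparison-on compareℕ-isComparison leaves (λ _ → tt))
      (then-isComparison
        (isComparison-on (lexWith-isComparison (compareℕ-isComparison {λ _ → ⊤})) (partition k)
          (λ {t} _ → All.universal (λ _ → tt) (partition k t)))
        (isComparison-on (lexWith-isComparison isComparison) (sortedChildren k) sortedChildren-SizeAtMost)))
    (λ {x} {y} _ _ → cmpF-suc k x y)

  children-eq⇒≅ : ∀ x y → SizeAtMost (suc k) x → SizeAtMost (suc k) y →
                  compareℕ (leaves x) (leaves y) ≡ eq →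
                  lexWith (cmpF k) (sortedChildren k x) (sortedChildren k y) ≡ eq → x ≅ y
  children-eq⇒≅ leaf leaf _ _ _ _ = leaf≅
  children-eq⇒≅ leaf (node (u ∷ us)) _ _ _ e
    rewrite lexWith-[]-insertBy (cmpF k) (cmpF k) u (sortBy (cmpF k) us) with e
  ... | ()
  children-eq⇒≅ (node (t ∷ ts)) leaf _ _ _ e
    rewrite lexWith-insertBy-[] (cmpF k) (cmpF k) t (sortBy (cmpF k) ts) with e
  ... | ()
  children-eq⇒≅ (node ts) (node us) (s≤s ts≤k) (s≤s us≤k) _ e =
    node≅ (onIndices ts↭us) (onIndices-lookup ts↭us)
    where
    ts↭us : ts ↭ us
    ts↭us = ↭-trans (↭-sym (sort-↭ ts)) (↭-trans (↭-reflexive-≋ sorted≋) (sort-↭ us))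
      where
      sorted≋ = Pointwise-mapWithAll eq⇒≅
        (All-sort (All-SizeAtMost ts ts≤k)) (All-sort (All-SizeAtMost us us≤k)) (lexWith-eq⁻ (cmpF k) e)

  eq⇒≅-suc : ∀ {x y} → SizeAtMost (suc k) x → SizeAtMost (suc k) y → cmpF (suc k) x y ≡ eq → x ≅ y
  eq⇒≅-suc {x} {y} x≤ y≤ e with then-eq (trans (sym (cmpF-suc k x y)) e)
  ... | leaves≈ , rest = children-eq⇒≅ x y x≤ y≤ leaves≈ (proj₂ (then-eq rest))

  ≅⇒eq-suc : ∀ {x y} → SizeAtMost (suc k) x → SizeAtMost (suc k) y → x ≅ y → cmpF (suc k) x y ≡ eq
  ≅⇒eq-suc _ _ leaf≅ = refl
  ≅⇒eq-suc {node ts} {node us} (s≤s ts≤k) (s≤s us≤k) x≅y@(node≅ π f) =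
    trans (cmpF-suc k (node ts) (node us)) (then-eq⁺ leaves≈ (then-eq⁺ partition≈ children≈))
    where
    bounded-ts = All-sort (All-SizeAtMost ts ts≤k)
    bounded-us = All-sort (All-SizeAtMost us us≤k)
    sorted≋ = sort-↭⇒≋ (All-SizeAtMost ts ts≤k) (All-SizeAtMost us us≤k) (↔⇒↭ ≅-setoid ts us π f)
    leaves≈ = compareℕ-eq⁺ (leaves-resp-≅ x≅y)
    partition≈ = lexWith-eq⁺ compareℕ
      (Pointwise.map⁺ leaves leaves (Pointwise.map (λ t≅u → compareℕ-eq⁺ (leaves-resp-≅ t≅u)) sorted≋))
    children≈ = lexWith-eq⁺ (cmpF k) (Pointwise-mapWithAll ≅⇒eq bounded-ts bounded-us sorted≋)

canonical : ∀ k → Canonical k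
canonical zero    = canonical-zero
canonical (suc k) = canonical-suc (canonical k)

cmpTree-eq⇔≅ : ∀ x y → (x ≅ y) ⇔ (cmpTree x y ≡ eq)
cmpTree-eq⇔≅ x y = mk⇔ (≅⇒eq x≤ y≤) (eq⇒≅ x≤ y≤)
  where
  open Canonical (canonical (size x + size y))
  x≤ = m≤m+n (size x) (size y)
  y≤ = m≤n+m (size y) (size x)

lemma1 : (n : ℕ) → 1 ≤ n → (T : Tree) → Valid T → leaves T ≡ n →
         (v w : Node T) → (subtree v ≅ subtree w) ⇔ (v ∼ w)
lemma1 _ _ _ _ _ v w = cmpTree-eq⇔≅ (subtree v) (subtree w)
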